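{- Let $q$ be any prime power and let $s,t\in\mathbb F_q$ with $t\neq0$ and $1+s+t\neq0$. Let $f_{s,t}=\frac{X^3+sX+t}{X(X-1)}$ and $G_{s,t}(X)=X^4-2X^3-sX^2-2tX+t$. The following are equivalent: (i) $|f_{s,t}^{ -1}(\alpha)|=2$ for some $\alpha\in\mathbb F_q$; (ii) $G_{s,t}$ has a root $x\in\mathbb F_q$ with $x^3\neq -t$; (iii) there exist $a,b\in\mathbb F_q$ with $a\neq b$ such that $t=-a^2b$ and $s=-2a-b+a^2+2ab$.
   Context: $\mathbb F_q$ is the field with $q$ elements. A rational function in $\mathbb F_q(X)$ induces a map $\mathbb P^1(\mathbb F_q)=\mathbb F_q\cup\{\infty\}\to\mathbb P^1(\mathbb F_q)$, and $f^{ -1}(\alpha)$ denotes the preimage of $\alpha$ in $\mathbb P^1(\mathbb F_q)$. -}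

module Defs where

open import Level using (0ℓ)
open import Data.List using (List; _∷_; []; map; filter; length)
open import Data.List.Membership.Propositional using (_∈_)
open import Data.List.Relation.Unary.Unique.Propositional using (Unique)
open import Data.Maybe using (Maybe; just; nothing)
open import Data.Maybe.Properties using (≡-dec)
open import Data.Nat using (ℕ)
open import Relation.Nullary using (¬_; yes; no)
open import Relation.Binary.PropositionalEquality using (_≡_)
open import Relation.Binary.Definitions using (DecidableEquality)
open import Algebra.Structures using (IsCommutativeRing)

record FiniteField : Set₁ where
  infixl 6 _+_ _-_
  infixl 7 _*_
  infix  8 -_
  field
    Carrier   : Set
    _+_ _*_   : Carrier → Carrier → Carrier
    -_        : Carrier → Carrier
    0# 1#     : Carrier
    isCommutativeRing : IsCommutativeRing _≡_ _+_ _*_ -_ 0# 1#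
    0≢1       : ¬ (0# ≡ 1#)
    _⁻¹       : Carrier → Carrier
    ⁻¹-inverse : ∀ x → ¬ (x ≡ 0#) → x * (x ⁻¹) ≡ 1#
    _≟_       : DecidableEquality Carrier
    elements  : List Carrier
    complete  : ∀ x → x ∈ elements
    unique    : Unique elements

  _-_ : Carrier → Carrier → Carrier
  x - y = x + (- y)

  2# : Carrier
  2# = 1# + 1#

  size : ℕ
  size = length elements

  -- P^1(F_q) = F_q ∪ {∞}, with nothing = ∞
  P1 : Set
  P1 = Maybe Carrier

  P1-elements : List P1
  P1-elements = nothing ∷ map just elements

  num : Carrier → Carrier → Carrier → Carrier
  num s t x = x * x * x + s * x + t

  den : Carrier → Carrier
  den x = x * (x - 1#)

  -- Under t ≠ 0 and 1+s+t ≠ 0 the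
  -- numerator and denominator are coprime, so the poles are exactly the roots
  -- of the denominator; and ∞ ↦ ∞ since deg num = 3 > 2 = deg den.
  f : Carrier → Carrier → P1 → P1
  f s t nothing = nothing
  f s t (just x) with den x ≟ 0#
  ... | yes _ = nothing
  ... | no  _ = just (num s t x * (den x ⁻¹))

  preimageSize : Carrier → Carrier → P1 → ℕ
  preimageSize s t β = length (filter (λ p → ≡-dec _≟_ (f s t p) β) P1-elements)

  G : Carrier → Carrier → Carrier → Carrier
  G s t x = x * x * x * x - 2# * (x * x * x) - s * (x * x) - 2# * t * x + t

-- For α ∈ F_q the finite points of f⁻¹(α) are the roots of the monic cubic
-- num − α·den = X³ − αX² + (s + α)X + t; the conditions t ≠ 0 and 1 + s + t ≠ 0 say
-- that num does not vanish at the poles 0 and 1, and ∞ ↦ ∞.  If the fibre has exactly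
-- two points a ≠ b, the third root α − a − b (the roots sum to α) is again in the
-- fibre, hence equals a or b: the cubic is (X − a)²(X − b), and comparing coefficients
-- gives (iii).  Conversely under (iii) the cubic over α = 2a + b is (X − a)²(X − b).
-- For (ii) ⇔ (iii), b = −t/a² eliminates b: the formula for s becomes G(a) = 0, and
-- a ≠ b becomes a³ ≠ −t.
module Submission where

open import Level using (0ℓ)
open import Algebra.Bundles using (CommutativeRing)
open import Algebra.Solver.Ring.AlmostCommutativeRing
  using (fromCommutativeRing; _-Raw-AlmostCommutative⟶_)
open import Data.Empty using (⊥-elim)
open import Data.Integer as ℤ using (ℤ; +_; -[1+_]; +0; +[1+_]; _⊖_; sign; ∣_∣; _◃_)
open import Data.Integer.Properties using ([1+m]⊖[1+n]≡m⊖n)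
open import Data.List using (List; []; _∷_; length; filter)
open import Data.List.Membership.Propositional using (_∈_)
open import Data.List.Membership.Propositional.Properties using (∈-filter⁺; ∈-filter⁻; ∈-map⁺)
open import Data.List.Relation.Unary.All using ([]; _∷_)
import Data.List.Relation.Unary.All as All
import Data.List.Relation.Unary.All.Properties as Allₚ
open import Data.List.Relation.Unary.AllPairs using ([]; _∷_)
open import Data.List.Relation.Unary.Any using (here; there)
open import Data.List.Relation.Unary.Unique.Propositional using (Unique)
import Data.List.Relation.Unary.Unique.Propositional.Properties as Unique
open import Data.Maybe as Maybe using (Maybe; just; nothing)
open import Data.Maybe.Properties using (≡-dec; just-injective)
open import Data.Nat as ℕ using (ℕ; zero; suc)
open import Data.Nat.Properties using (+-suc)
open import Data.Product using (_×_; _,_; proj₂; ∃; ∃₂; ∃-syntax)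
open import Data.Sign as Sign using (Sign)
open import Data.Sum as Sum using (_⊎_; inj₁; inj₂; [_,_]′)
open import Function using (_∘_; id; _⇔_; mk⇔; Equivalence)
import Function.Properties.Equivalence as ⇔
open import Relation.Binary.PropositionalEquality
  using (_≡_; _≢_; refl; sym; trans; cong; module ≡-Reasoning)
open import Relation.Nullary using (¬_; yes; no)
open import Relation.Nullary.Decidable using (dec⇒maybe)
open import Relation.Unary using (Decidable)

open import Defs

-- Algebra.Solver.Ring decides identities by evaluating coefficient arithmetic, which
-- does not compute in an abstract ring; ℤ mapped in by its canonical homomorphism does.
-- The type-checking-optimised multiple makes ⟦ + 2 ⟧ℤ reduce to 1# + 1#.
module IntegerCoefficients {c ℓ} (R : CommutativeRing c ℓ) where
  open CommutativeRing R renaming (refl to ≈-refl; sym to ≈-sym; trans to ≈-trans)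
  open import Algebra.Properties.Ring ring
    using (-0#≈0#; -‿involutive; -‿+-comm; -‿distribˡ-*; -‿distribʳ-*)
  open import Algebra.Properties.CommutativeSemigroup +-commutativeSemigroup using (interchange)
  open import Algebra.Properties.Semiring.Mult.TCOptimised semiring
    using (1+×; ×-homo-+; ×1-homo-*) renaming (_×_ to _×ₙ_)
  open import Relation.Binary.Reasoning.Setoid setoid

  signed : Sign → Carrier → Carrier
  signed Sign.+ x = x
  signed Sign.- x = - x

  signed-cong : ∀ s {x y} → x ≈ y → signed s x ≈ signed s y
  signed-cong Sign.+ x≈y = x≈y
  signed-cong Sign.- x≈y = -‿cong x≈y

  signed-* : ∀ s r x y → signed (s Sign.* r) (x * y) ≈ signed s x * signed r y
  signed-* Sign.+ Sign.+ x y = ≈-refl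
  signed-* Sign.+ Sign.- x y = -‿distribʳ-* x y
  signed-* Sign.- Sign.+ x y = -‿distribˡ-* x y
  signed-* Sign.- Sign.- x y = begin
    x * y         ≈⟨ -‿involutive (x * y) ⟨
    - - (x * y)   ≈⟨ -‿cong (-‿distribˡ-* x y) ⟩
    - (- x * y)   ≈⟨ -‿distribʳ-* (- x) y ⟩
    - x * - y     ∎

  ⟦_⟧ℤ : ℤ → Carrier
  ⟦ i ⟧ℤ = signed (sign i) (∣ i ∣ ×ₙ 1#)

  ◃-homo : ∀ s n → ⟦ s ◃ n ⟧ℤ ≈ signed s (n ×ₙ 1#)
  ◃-homo Sign.+ zero    = ≈-refl
  ◃-homo Sign.- zero    = ≈-sym -0#≈0#
  ◃-homo Sign.+ (suc n) = ≈-refl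
  ◃-homo Sign.- (suc n) = ≈-refl

  1+x-[1+y]≈x-y : ∀ x y → (1# + x) - (1# + y) ≈ x - y
  1+x-[1+y]≈x-y x y = begin
    (1# + x) - (1# + y)       ≈⟨ +-congˡ (-‿+-comm 1# y) ⟨
    (1# + x) + (- 1# + - y)   ≈⟨ interchange 1# x (- 1#) (- y) ⟩
    (1# - 1#) + (x - y)       ≈⟨ +-congʳ (-‿inverseʳ 1#) ⟩
    0# + (x - y)              ≈⟨ +-identityˡ (x - y) ⟩
    x - y                     ∎

  ⊖-homo : ∀ m n → ⟦ m ⊖ n ⟧ℤ ≈ m ×ₙ 1# - n ×ₙ 1#
  ⊖-homo m       zero    = ≈-sym (≈-trans (+-congˡ -0#≈0#) (+-identityʳ _))
  ⊖-homo zero    (suc n) = ≈-sym (+-identityˡ _)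
  ⊖-homo (suc m) (suc n) = begin
    ⟦ suc m ⊖ suc n ⟧ℤ            ≡⟨ cong ⟦_⟧ℤ ([1+m]⊖[1+n]≡m⊖n m n) ⟩
    ⟦ m ⊖ n ⟧ℤ                    ≈⟨ ⊖-homo m n ⟩
    m ×ₙ 1# - n ×ₙ 1#               ≈⟨ 1+x-[1+y]≈x-y (m ×ₙ 1#) (n ×ₙ 1#) ⟨
    (1# + m ×ₙ 1#) - (1# + n ×ₙ 1#) ≈⟨ +-cong (1+× m 1#) (-‿cong (1+× n 1#)) ⟨
    suc m ×ₙ 1# - suc n ×ₙ 1#       ∎

  +-homo : ∀ i j → ⟦ i ℤ.+ j ⟧ℤ ≈ ⟦ i ⟧ℤ + ⟦ j ⟧ℤ
  +-homo (+ m)    (+ n)    = ×-homo-+ 1# m n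
  +-homo (+ m)    -[1+ n ] = ⊖-homo m (suc n)
  +-homo -[1+ m ] (+ n)    = ≈-trans (⊖-homo n (suc m)) (+-comm _ _)
  +-homo -[1+ m ] -[1+ n ] = begin
    - (suc (suc (m ℕ.+ n)) ×ₙ 1#)    ≡⟨ cong (λ k → - (suc k ×ₙ 1#)) (+-suc m n) ⟨
    - ((suc m ℕ.+ suc n) ×ₙ 1#)      ≈⟨ -‿cong (×-homo-+ 1# (suc m) (suc n)) ⟩
    - (suc m ×ₙ 1# + suc n ×ₙ 1#)     ≈⟨ -‿+-comm _ _ ⟨
    - (suc m ×ₙ 1#) + - (suc n ×ₙ 1#) ∎

  *-homo : ∀ i j → ⟦ i ℤ.* j ⟧ℤ ≈ ⟦ i ⟧ℤ * ⟦ j ⟧ℤ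
  *-homo i j = begin
    ⟦ i ℤ.* j ⟧ℤ                          ≈⟨ ◃-homo s (∣ i ∣ ℕ.* ∣ j ∣) ⟩
    signed s ((∣ i ∣ ℕ.* ∣ j ∣) ×ₙ 1#)     ≈⟨ signed-cong s (×1-homo-* ∣ i ∣ ∣ j ∣) ⟩
    signed s (∣ i ∣ ×ₙ 1# * ∣ j ∣ ×ₙ 1#)    ≈⟨ signed-* (sign i) (sign j) _ _ ⟩
    ⟦ i ⟧ℤ * ⟦ j ⟧ℤ                       ∎
    where
    s : Sign
    s = sign i Sign.* sign j

  -‿homo : ∀ i → ⟦ ℤ.- i ⟧ℤ ≈ - ⟦ i ⟧ℤ
  -‿homo +0       = ≈-sym -0#≈0#
  -‿homo +[1+ n ] = ≈-refl
  -‿homo -[1+ n ] = ≈-sym (-‿involutive _)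

  homomorphism : ℤ.+-*-rawRing -Raw-AlmostCommutative⟶ fromCommutativeRing R
  homomorphism = record
    { ⟦_⟧    = ⟦_⟧ℤ
    ; +-homo = +-homo
    ; *-homo = *-homo
    ; -‿homo = -‿homo
    ; 0-homo = ≈-refl
    ; 1-homo = ≈-refl
    }

  ⟦⟧ℤ-dec : ∀ i j → Maybe (⟦ i ⟧ℤ ≈ ⟦ j ⟧ℤ)
  ⟦⟧ℤ-dec i j = Maybe.map (reflexive ∘ cong ⟦_⟧ℤ) (dec⇒maybe (i ℤ.≟ j))

  open import Algebra.Solver.Ring ℤ.+-*-rawRing (fromCommutativeRing R) homomorphism ⟦⟧ℤ-dec public

private
  variable
    A : Set

ExactlyTwo : (A → Set) → Set
ExactlyTwo P = ∃₂ λ a b → a ≢ b × (∀ x → P x ⇔ (x ≡ a ⊎ x ≡ b))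

ExactlyTwo-cong : ∀ {P Q : A → Set} → (∀ x → P x ⇔ Q x) → ExactlyTwo P ⇔ ExactlyTwo Q
ExactlyTwo-cong P⇔Q = mk⇔
  (λ (a , b , a≢b , P⇔) → a , b , a≢b , λ x → ⇔.trans (⇔.sym (P⇔Q x)) (P⇔ x))
  (λ (a , b , a≢b , Q⇔) → a , b , a≢b , λ x → ⇔.trans (P⇔Q x) (Q⇔ x))

pigeonhole : ∀ {a b x y z : A} → x ≡ a ⊎ x ≡ b → y ≡ a ⊎ y ≡ b → z ≡ a ⊎ z ≡ b →
             x ≡ y ⊎ x ≡ z ⊎ y ≡ z
pigeonhole (inj₁ refl) (inj₁ refl) _           = inj₁ refl
pigeonhole (inj₂ refl) (inj₂ refl) _           = inj₁ refl
pigeonhole (inj₁ refl) (inj₂ refl) (inj₁ refl) = inj₂ (inj₁ refl)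
pigeonhole (inj₂ refl) (inj₁ refl) (inj₂ refl) = inj₂ (inj₁ refl)
pigeonhole (inj₁ refl) (inj₂ refl) (inj₂ refl) = inj₂ (inj₂ refl)
pigeonhole (inj₂ refl) (inj₁ refl) (inj₁ refl) = inj₂ (inj₂ refl)

Unique⇒length≡2⇔ExactlyTwo : ∀ {A : Set} {xs : List A} → Unique xs → length xs ≡ 2 ⇔ ExactlyTwo (_∈ xs)
Unique⇒length≡2⇔ExactlyTwo {A = A} {xs} unique = mk⇔ (to xs unique) from
  where
  to : ∀ ys → Unique ys → length ys ≡ 2 → ExactlyTwo (_∈ ys)
  to (u ∷ v ∷ []) ((u≢v ∷ []) ∷ _) refl = u , v , u≢v , λ x → mk⇔ member pair
    where
    member : ∀ {x : A} → x ∈ u ∷ v ∷ [] → x ≡ u ⊎ x ≡ v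
    member (here x≡u)         = inj₁ x≡u
    member (there (here x≡v)) = inj₂ x≡v
    pair : ∀ {x : A} → x ≡ u ⊎ x ≡ v → x ∈ u ∷ v ∷ []
    pair (inj₁ x≡u) = here x≡u
    pair (inj₂ x≡v) = there (here x≡v)
  from : ExactlyTwo (_∈ xs) → length xs ≡ 2
  from (a , b , a≢b , ∈⇔) = go xs unique (Equivalence.to ∘ ∈⇔)
    (Equivalence.from (∈⇔ a) (inj₁ refl)) (Equivalence.from (∈⇔ b) (inj₂ refl))
    where
    go : ∀ ys → Unique ys → (∀ x → x ∈ ys → x ≡ a ⊎ x ≡ b) → a ∈ ys → b ∈ ys → length ys ≡ 2
    go (x ∷ []) _ _ (here a≡x) (here b≡x) = ⊥-elim (a≢b (trans a≡x (sym b≡x)))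
    go (x ∷ y ∷ []) _ _ _ _ = refl
    go (x ∷ y ∷ z ∷ _) ((x≢y ∷ x≢z ∷ _) ∷ (y≢z ∷ _) ∷ _) ∈ab _ _ =
      ⊥-elim ([ x≢y , [ x≢z , y≢z ]′ ]′
        (pigeonhole (∈ab x (here refl)) (∈ab y (there (here refl))) (∈ab z (there (there (here refl))))))

just≡just⊎just≡just⇔ : ∀ {x a b : A} → (just x ≡ just a ⊎ just x ≡ just b) ⇔ (x ≡ a ⊎ x ≡ b)
just≡just⊎just≡just⇔ = mk⇔ (Sum.map just-injective just-injective) (Sum.map (cong just) (cong just))

ExactlyTwo-just⇔ : ∀ {P : Maybe A → Set} → ¬ P nothing → ExactlyTwo P ⇔ ExactlyTwo (P ∘ just)
ExactlyTwo-just⇔ {P = P} ¬P-nothing = mk⇔ to from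
  where
  to : ExactlyTwo P → ExactlyTwo (P ∘ just)
  to (nothing , _ , _ , P⇔) = ⊥-elim (¬P-nothing (Equivalence.from (P⇔ nothing) (inj₁ refl)))
  to (_ , nothing , _ , P⇔) = ⊥-elim (¬P-nothing (Equivalence.from (P⇔ nothing) (inj₂ refl)))
  to (just a , just b , a≢b , P⇔) =
    a , b , a≢b ∘ cong just , λ x → ⇔.trans (P⇔ (just x)) just≡just⊎just≡just⇔
  from : ExactlyTwo (P ∘ just) → ExactlyTwo P
  from (a , b , a≢b , P⇔) = just a , just b , a≢b ∘ just-injective , λ
    { nothing  → mk⇔ (⊥-elim ∘ ¬P-nothing) λ { (inj₁ ()) ; (inj₂ ()) }
    ; (just x) → ⇔.trans (P⇔ x) (⇔.sym just≡just⊎just≡just⇔)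
    }

∈-filter⇔ : ∀ {P : A → Set} (P? : Decidable P) {xs x} → x ∈ xs → x ∈ filter P? xs ⇔ P x
∈-filter⇔ P? {xs} x∈xs = mk⇔ (proj₂ ∘ ∈-filter⁻ P? {xs = xs}) (∈-filter⁺ P? x∈xs)

module FieldProperties (F : FiniteField) where
  open FiniteField F
  open ≡-Reasoning

  commutativeRing : CommutativeRing 0ℓ 0ℓ
  commutativeRing = record { isCommutativeRing = isCommutativeRing }

  open CommutativeRing commutativeRing using (ring; *-identityˡ; zeroʳ)
  open import Algebra.Properties.Ring ring using (x∙y⁻¹≈ε⇒x≈y; x≈y⇒x∙y⁻¹≈ε)
  open IntegerCoefficients commutativeRing public
    using (Polynomial; solve; _:=_; con; _:+_; _:-_; _:*_; :-_)

  :0 :1 :2 : ∀ {n} → Polynomial n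
  :0 = con (+ 0)
  :1 = con (+ 1)
  :2 = con (+ 2)

  x-y≡0⇒x≡y : ∀ {x y} → x - y ≡ 0# → x ≡ y
  x-y≡0⇒x≡y = x∙y⁻¹≈ε⇒x≈y _ _

  x≡y⇒x-y≡0 : ∀ {x y} → x ≡ y → x - y ≡ 0#
  x≡y⇒x-y≡0 = x≈y⇒x∙y⁻¹≈ε

  ⁻¹-cancelˡ : ∀ {x} y → x ≢ 0# → x ⁻¹ * (x * y) ≡ y
  ⁻¹-cancelˡ {x} y x≢0 = begin
    x ⁻¹ * (x * y) ≡⟨ solve 3 (λ x x⁻¹ y → x⁻¹ :* (x :* y) := x :* x⁻¹ :* y) refl x (x ⁻¹) y ⟩
    x * x ⁻¹ * y   ≡⟨ cong (_* y) (⁻¹-inverse x x≢0) ⟩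
    1# * y         ≡⟨ *-identityˡ y ⟩
    y              ∎

  *-cancelˡ : ∀ {x y z} → x ≢ 0# → x * y ≡ x * z → y ≡ z
  *-cancelˡ {x} {y} {z} x≢0 xy≡xz = begin
    y              ≡⟨ ⁻¹-cancelˡ y x≢0 ⟨
    x ⁻¹ * (x * y) ≡⟨ cong (x ⁻¹ *_) xy≡xz ⟩
    x ⁻¹ * (x * z) ≡⟨ ⁻¹-cancelˡ z x≢0 ⟩
    z              ∎

  x*y≡0⇒x≡0⊎y≡0 : ∀ {x y} → x * y ≡ 0# → x ≡ 0# ⊎ y ≡ 0#
  x*y≡0⇒x≡0⊎y≡0 {x} {y} xy≡0 with x ≟ 0#
  ... | yes x≡0 = inj₁ x≡0
  ... | no  x≢0 = inj₂ (*-cancelˡ x≢0 (trans xy≡0 (sym (zeroʳ x))))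

  x*y⁻¹≡z⇔x≡z*y : ∀ {x y z} → y ≢ 0# → x * y ⁻¹ ≡ z ⇔ x ≡ z * y
  x*y⁻¹≡z⇔x≡z*y {x} {y} {z} y≢0 = mk⇔
    (λ xy⁻¹≡z → begin
      x              ≡⟨ ⁻¹-cancelˡ x y≢0 ⟨
      y ⁻¹ * (y * x) ≡⟨ solve 3 (λ x y y⁻¹ → y⁻¹ :* (y :* x) := x :* y⁻¹ :* y) refl x y (y ⁻¹) ⟩
      x * y ⁻¹ * y   ≡⟨ cong (_* y) xy⁻¹≡z ⟩
      z * y          ∎)
    (λ x≡zy → begin
      x * y ⁻¹       ≡⟨ cong (_* y ⁻¹) x≡zy ⟩
      z * y * y ⁻¹   ≡⟨ solve 3 (λ z y y⁻¹ → z :* y :* y⁻¹ := y⁻¹ :* (y :* z)) refl z y (y ⁻¹) ⟩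
      y ⁻¹ * (y * z) ≡⟨ ⁻¹-cancelˡ z y≢0 ⟩
      z              ∎)

  linear-combination₁ : ∀ {e k h} → e ≡ k * h → h ≡ 0# → e ≡ 0#
  linear-combination₁ {k = k} e≡kh refl = trans e≡kh (zeroʳ k)

  linear-combination₂ : ∀ {e k₁ h₁ k₂ h₂} → e ≡ k₁ * h₁ + k₂ * h₂ → h₁ ≡ 0# → h₂ ≡ 0# → e ≡ 0#
  linear-combination₂ {k₁ = k₁} {k₂ = k₂} e≡ refl refl =
    trans e≡ (solve 2 (λ k₁ k₂ → k₁ :* :0 :+ k₂ :* :0 := :0) refl k₁ k₂)

module Polynomials (F : FiniteField) where
  open FiniteField F
  open FieldProperties F
  open ≡-Reasoning

  Root : (Carrier → Carrier) → Carrier → Set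
  Root p x = p x ≡ 0#

  cubic : Carrier → Carrier → Carrier → Carrier → Carrier
  cubic s t α x = num s t x - α * den x

  divided-difference : Carrier → Carrier → Carrier → Carrier → Carrier
  divided-difference s α a b = a * a + a * b + b * b - α * (a + b) + s + α

  -- cubic (coeff-s a b) (coeff-t a b) (2a + b) = (X − a)²(X − b), see cubic-factorisation.
  coeff-s coeff-t : Carrier → Carrier → Carrier
  coeff-s a b = - (2# * a) - b + a * a + 2# * a * b
  coeff-t a b = - (a * a * b)

  Parametrisable : Carrier → Carrier → Set
  Parametrisable s t = ∃₂ λ a b → a ≢ b × t ≡ coeff-t a b × s ≡ coeff-s a b

  module _ {n : ℕ} where
    num′ : Polynomial n → Polynomial n → Polynomial n → Polynomial n
    num′ s t x = x :* x :* x :+ s :* x :+ t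

    den′ : Polynomial n → Polynomial n
    den′ x = x :* (x :- :1)

    cubic′ : Polynomial n → Polynomial n → Polynomial n → Polynomial n → Polynomial n
    cubic′ s t α x = num′ s t x :- α :* den′ x

    divided-difference′ : Polynomial n → Polynomial n → Polynomial n → Polynomial n → Polynomial n
    divided-difference′ s α a b = a :* a :+ a :* b :+ b :* b :- α :* (a :+ b) :+ s :+ α

    coeff-s′ coeff-t′ : Polynomial n → Polynomial n → Polynomial n
    coeff-s′ a b = :- (:2 :* a) :- b :+ a :* a :+ :2 :* a :* b
    coeff-t′ a b = :- (a :* a :* b)

    G′ : Polynomial n → Polynomial n → Polynomial n → Polynomial n
    G′ s t x = x :* x :* x :* x :- :2 :* (x :* x :* x) :- s :* (x :* x) :- :2 :* t :* x :+ t

  divided-difference≡0 : ∀ s t α {a b} → Root (cubic s t α) a → Root (cubic s t α) b → a ≢ b →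
                         divided-difference s α a b ≡ 0#
  divided-difference≡0 s t α {a} {b} a-root b-root a≢b =
    [ ⊥-elim ∘ a≢b ∘ sym ∘ x-y≡0⇒x≡y , id ]′ (x*y≡0⇒x≡0⊎y≡0 (linear-combination₂ (solve 5 (λ s t α a b →
      (b :- a) :* divided-difference′ s α a b := :1 :* cubic′ s t α b :+ :- :1 :* cubic′ s t α a)
      refl s t α a b) b-root a-root))

  -- The roots of the monic cubic X³ − αX² + (s + α)X + t sum to α.
  third-root : ∀ s t α {a b} → Root (cubic s t α) a → divided-difference s α a b ≡ 0# →
               Root (cubic s t α) (α - a - b)
  third-root s t α {a} {b} = linear-combination₂ (solve 5 (λ s t α a b →
    cubic′ s t α (α :- a :- b)
    := :1 :* cubic′ s t α a :+ (α :- a :- b :- a) :* divided-difference′ s α a b) refl s t α a b)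

  x-y-z≡y⇒x≡2y+z : ∀ {x y z} → x - y - z ≡ y → x ≡ 2# * y + z
  x-y-z≡y⇒x≡2y+z {x} {y} {z} e = x-y≡0⇒x≡y (linear-combination₁ (solve 3 (λ x y z →
    x :- (:2 :* y :+ z) := :1 :* (x :- y :- z :- y)) refl x y z) (x≡y⇒x-y≡0 e))

  x-y-z≡z⇒x≡2z+y : ∀ {x y z} → x - y - z ≡ z → x ≡ 2# * z + y
  x-y-z≡z⇒x≡2z+y {x} {y} {z} e = x-y≡0⇒x≡y (linear-combination₁ (solve 3 (λ x y z →
    x :- (:2 :* z :+ y) := :1 :* (x :- y :- z :- z)) refl x y z) (x≡y⇒x-y≡0 e))

  double-root-coefficients : ∀ {s t α a b} → α ≡ 2# * a + b →
    Root (cubic s t α) a → Root (cubic s t α) b → a ≢ b → t ≡ coeff-t a b × s ≡ coeff-s a b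
  double-root-coefficients {s} {t} {a = a} {b} refl a-root b-root a≢b =
    x-y≡0⇒x≡y (linear-combination₂ (solve 4 (λ s t a b →
      t :- coeff-t′ a b
      := :1 :* cubic′ s t (:2 :* a :+ b) a :+ :- a :* divided-difference′ s (:2 :* a :+ b) a b)
      refl s t a b) a-root dd≡0) ,
    x-y≡0⇒x≡y (linear-combination₁ (solve 3 (λ s a b →
      s :- coeff-s′ a b := :1 :* divided-difference′ s (:2 :* a :+ b) a b) refl s a b) dd≡0)
    where
    dd≡0 : divided-difference s (2# * a + b) a b ≡ 0#
    dd≡0 = divided-difference≡0 s t (2# * a + b) a-root b-root a≢b

  ExactlyTwo-Root⇒Parametrisable : ∀ {s t α} → ExactlyTwo (Root (cubic s t α)) → Parametrisable s t
  ExactlyTwo-Root⇒Parametrisable {s} {t} {α} (a , b , a≢b , roots) =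
    [ (λ r≡a → a , b , a≢b , double-root-coefficients (x-y-z≡y⇒x≡2y+z r≡a) a-root b-root a≢b)
    , (λ r≡b → b , a , b≢a , double-root-coefficients (x-y-z≡z⇒x≡2z+y r≡b) b-root a-root b≢a)
    ]′ (Equivalence.to (roots (α - a - b)) (third-root s t α a-root dd≡0))
    where
    b≢a : b ≢ a
    b≢a = a≢b ∘ sym
    a-root : Root (cubic s t α) a
    a-root = Equivalence.from (roots a) (inj₁ refl)
    b-root : Root (cubic s t α) b
    b-root = Equivalence.from (roots b) (inj₂ refl)
    dd≡0 : divided-difference s α a b ≡ 0#
    dd≡0 = divided-difference≡0 s t α a-root b-root a≢b

  cubic-factorisation : ∀ a b x →
    cubic (coeff-s a b) (coeff-t a b) (2# * a + b) x ≡ (x - a) * (x - a) * (x - b)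
  cubic-factorisation = solve 3 (λ a b x →
    cubic′ (coeff-s′ a b) (coeff-t′ a b) (:2 :* a :+ b) x := (x :- a) :* (x :- a) :* (x :- b)) refl

  coefficients⇒ExactlyTwo-Root : ∀ {s t a b} → a ≢ b → t ≡ coeff-t a b → s ≡ coeff-s a b →
                                 ExactlyTwo (Root (cubic s t (2# * a + b)))
  coefficients⇒ExactlyTwo-Root {a = a} {b} a≢b refl refl = a , b , a≢b , λ x → mk⇔ (to x) from
    where
    p : Carrier → Carrier
    p = cubic (coeff-s a b) (coeff-t a b) (2# * a + b)
    to : ∀ x → Root p x → x ≡ a ⊎ x ≡ b
    to x root with x*y≡0⇒x≡0⊎y≡0 (trans (sym (cubic-factorisation a b x)) root)
    ... | inj₁ [x-a]²≡0 = inj₁ (x-y≡0⇒x≡y (Sum.reduce (x*y≡0⇒x≡0⊎y≡0 [x-a]²≡0)))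
    ... | inj₂ x-b≡0    = inj₂ (x-y≡0⇒x≡y x-b≡0)
    from : ∀ {x} → x ≡ a ⊎ x ≡ b → Root p x
    from (inj₁ refl) = trans (cubic-factorisation a b a)
      (solve 2 (λ a b → (a :- a) :* (a :- a) :* (a :- b) := :0) refl a b)
    from (inj₂ refl) = trans (cubic-factorisation a b b)
      (solve 2 (λ a b → (b :- a) :* (b :- a) :* (b :- b) := :0) refl a b)

  coefficients⇒G-root : ∀ {s t a b} → t ≢ 0# → a ≢ b → t ≡ coeff-t a b → s ≡ coeff-s a b →
                        Root (G s t) a × a * a * a ≢ - t
  coefficients⇒G-root {a = a} {b} t≢0 a≢b refl refl =
    solve 2 (λ a b → G′ (coeff-s′ a b) (coeff-t′ a b) a := :0) refl a b , a³≢-t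
    where
    a³≢-t : a * a * a ≢ - coeff-t a b
    a³≢-t a³≡-t with x*y≡0⇒x≡0⊎y≡0 (trans
      (solve 2 (λ a b → a :* a :* (a :- b) := a :* a :* a :- :- coeff-t′ a b) refl a b) (x≡y⇒x-y≡0 a³≡-t))
    ... | inj₁ a²≡0  = t≢0 (linear-combination₁
      (solve 2 (λ a b → coeff-t′ a b := :- b :* (a :* a)) refl a b) a²≡0)
    ... | inj₂ a-b≡0 = a≢b (x-y≡0⇒x≡y a-b≡0)

  G-root⇒coefficients : ∀ {s t x} → t ≢ 0# → Root (G s t) x → x * x * x ≢ - t →
                        ∃ λ b → x ≢ b × t ≡ coeff-t x b × s ≡ coeff-s x b
  G-root⇒coefficients {s} {t} {x} t≢0 x-root x³≢-t = b , x≢b , t≡ , s≡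
    where
    x≢0 : x ≢ 0#
    x≢0 x≡0 = t≢0 (begin
      t          ≡⟨ solve 2 (λ s t → t := G′ s t :0) refl s t ⟩
      G s t 0#   ≡⟨ cong (G s t) x≡0 ⟨
      G s t x    ≡⟨ x-root ⟩
      0#         ∎)
    x²≢0 : x * x ≢ 0#
    x²≢0 = [ x≢0 , x≢0 ]′ ∘ x*y≡0⇒x≡0⊎y≡0
    b : Carrier
    b = - t * (x * x) ⁻¹
    -t≡bx² : - t ≡ b * (x * x)
    -t≡bx² = Equivalence.to (x*y⁻¹≡z⇔x≡z*y x²≢0) refl
    t≡ : t ≡ coeff-t x b
    t≡ = x-y≡0⇒x≡y (linear-combination₁ (solve 3 (λ t x b →
      t :- coeff-t′ x b := :- :1 :* (:- t :- b :* (x :* x))) refl t x b) (x≡y⇒x-y≡0 -t≡bx²))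
    s≡ : s ≡ coeff-s x b
    s≡ = *-cancelˡ x²≢0 (x-y≡0⇒x≡y (linear-combination₂ (solve 4 (λ s t x b →
      x :* x :* s :- x :* x :* coeff-s′ x b
      := :- :1 :* G′ s t x :+ (:2 :* x :- :1) :* (:- t :- b :* (x :* x))) refl s t x b)
      x-root (x≡y⇒x-y≡0 -t≡bx²)))
    x≢b : x ≢ b
    x≢b x≡b = x³≢-t (begin
      x * x * x    ≡⟨ solve 1 (λ x → x :* x :* x := x :* (x :* x)) refl x ⟩
      x * (x * x)  ≡⟨ cong (_* (x * x)) x≡b ⟩
      b * (x * x)  ≡⟨ -t≡bx² ⟨
      - t          ∎)

  ∃G-root⇔Parametrisable : ∀ {s t} → t ≢ 0# →
                           (∃[ x ] (G s t x ≡ 0# × x * x * x ≢ - t)) ⇔ Parametrisable s t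
  ∃G-root⇔Parametrisable t≢0 = mk⇔
    (λ (x , x-root , x³≢-t) → x , G-root⇒coefficients t≢0 x-root x³≢-t)
    (λ (a , b , a≢b , t≡ , s≡) → a , coefficients⇒G-root t≢0 a≢b t≡ s≡)

module Preimages (F : FiniteField) where
  open FiniteField F
  open FieldProperties F
  open Polynomials F

  P1-elements-unique : Unique P1-elements
  P1-elements-unique = Allₚ.map⁺ (All.tabulate λ _ ()) ∷ Unique.map⁺ just-injective unique

  P1-elements-complete : ∀ p → p ∈ P1-elements
  P1-elements-complete nothing  = here refl
  P1-elements-complete (just x) = there (∈-map⁺ just (complete x))

  preimageSize≡2⇔ExactlyTwo : ∀ s t β → preimageSize s t β ≡ 2 ⇔ ExactlyTwo (λ p → f s t p ≡ β)
  preimageSize≡2⇔ExactlyTwo s t β = ⇔.trans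
    (Unique⇒length≡2⇔ExactlyTwo (Unique.filter⁺ P? P1-elements-unique))
    (ExactlyTwo-cong λ p → ∈-filter⇔ P? (P1-elements-complete p))
    where
    P? : Decidable (λ p → f s t p ≡ β)
    P? p = ≡-dec _≟_ (f s t p) β

  den≡0⇒num≢0 : ∀ {s t x} → t ≢ 0# → 1# + s + t ≢ 0# → den x ≡ 0# → num s t x ≢ 0#
  den≡0⇒num≢0 {s} {t} t≢0 1+s+t≢0 den≡0 num≡0 with x*y≡0⇒x≡0⊎y≡0 den≡0
  ... | inj₁ refl = t≢0 (trans (solve 2 (λ s t → t := num′ s t :0) refl s t) num≡0)
  ... | inj₂ x-1≡0 with x-y≡0⇒x≡y x-1≡0
  ...   | refl = 1+s+t≢0 (trans (solve 2 (λ s t → :1 :+ s :+ t := num′ s t :1) refl s t) num≡0)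

  f-just≡just⇔Root : ∀ {s t} → t ≢ 0# → 1# + s + t ≢ 0# →
                     ∀ α x → f s t (just x) ≡ just α ⇔ Root (cubic s t α) x
  f-just≡just⇔Root {s} {t} t≢0 1+s+t≢0 α x with den x ≟ 0#
  ... | yes den≡0 = mk⇔ (λ ()) λ root →
    ⊥-elim (den≡0⇒num≢0 t≢0 1+s+t≢0 den≡0 (linear-combination₁ (x-y≡0⇒x≡y root) den≡0))
  ... | no den≢0 = ⇔.trans (mk⇔ just-injective (cong just))
                  (⇔.trans (x*y⁻¹≡z⇔x≡z*y den≢0) (mk⇔ x≡y⇒x-y≡0 x-y≡0⇒x≡y))

  ∃preimageSize≡2⇔Parametrisable : ∀ {s t} → t ≢ 0# → 1# + s + t ≢ 0# →
                                   (∃[ α ] preimageSize s t (just α) ≡ 2) ⇔ Parametrisable s t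
  ∃preimageSize≡2⇔Parametrisable {s} {t} t≢0 1+s+t≢0 = mk⇔
    (λ (α , size≡2) → ExactlyTwo-Root⇒Parametrisable (Equivalence.to (size≡2⇔ α) size≡2))
    (λ (a , b , a≢b , t≡ , s≡) →
      2# * a + b , Equivalence.from (size≡2⇔ _) (coefficients⇒ExactlyTwo-Root a≢b t≡ s≡))
    where
    size≡2⇔ : ∀ α → preimageSize s t (just α) ≡ 2 ⇔ ExactlyTwo (Root (cubic s t α))
    size≡2⇔ α = ⇔.trans (preimageSize≡2⇔ExactlyTwo s t (just α))
                (⇔.trans (ExactlyTwo-just⇔ λ ()) (ExactlyTwo-cong (f-just≡just⇔Root t≢0 1+s+t≢0 α)))

theorem6p1 : (F : FiniteField) → let open FiniteField F in
    (s t : Carrier) → ¬ (t ≡ 0#) → ¬ (1# + s + t ≡ 0#) →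
      ((∃[ α ] preimageSize s t (just α) ≡ 2) ⇔ (∃[ x ] (G s t x ≡ 0# × ¬ (x * x * x ≡ - t))))
      × ((∃[ x ] (G s t x ≡ 0# × ¬ (x * x * x ≡ - t))) ⇔ (∃[ a ] ∃[ b ] (¬ (a ≡ b) × t ≡ - (a * a * b) × s ≡ - (2# * a) - b + a * a + 2# * a * b)))
theorem6p1 F s t t≢0 1+s+t≢0 =
  ⇔.trans (∃preimageSize≡2⇔Parametrisable t≢0 1+s+t≢0) (⇔.sym (∃G-root⇔Parametrisable t≢0)) ,
  ∃G-root⇔Parametrisable t≢0
  where
  open Polynomials F using (∃G-root⇔Parametrisable)
  open Preimages F using (∃preimageSize≡2⇔Parametrisable)
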